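{- Let $A$ be a positive integer. The equation $x^2 - A y^2 = -1$ has a solution in integers $x, y$ if and only if there exist natural numbers $r, s \in \mathbb{N}$ with $A = r^2 + s^2$ such that the Diophantine equation $$ s m^2 - 2 r m n - s n^2 = \pm 1 $$ (for one of the two choices of sign) has a solution in integers $m, n$.
   Context: $\mathbb{N}$ denotes the natural numbers. "The equation $s m^2 - 2rmn - s n^2 = \pm 1$ has an integral solution" means there exist integers $m,n$ with $s m^2 - 2rmn - s n^2 \in \{1,-1\}$. -}

{-# OPTIONS --safe #-}
module Submission where

-- Work in the Gaussian integers ℤ[i], where x² − A y² = −1 says N(x + i) = A y².  By descent on n
-- (reduce x modulo n, then lift), whenever x² + 1 = n k the Gaussian integer x + i has a factor α of
-- norm n.  For n = |y| the cofactor β has norm A |y|, and |y| divides β ᾱ, so x + i = γ α² with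
-- N γ = A.  For γ = r + s i and α = m − n i, Im(γ α²) = s m² − 2 r m n − s n² is then 1 and
-- r² + s² = A; the signs of r and s are absorbed into n and the ±.  Conversely, for such r, s, m, n,
-- (r + s i)(m − n i)² = x ± i, and taking norms gives x² + 1 = A (m² + n²)².

open import Data.Nat as ℕ using (ℕ; zero; suc; NonZero)
import Data.Nat.Properties as ℕ
open import Data.Nat.Induction using (<-rec)
open import Data.Nat.Tactic.RingSolver using () renaming (solve-∀ to ℕ-solve-∀)
open import Data.Integer as ℤ using (ℤ; +_; -[1+_]; _+_; _-_; _*_; -_; 1ℤ; 0ℤ; ∣_∣; _%ℕ_; _/ℕ_)
open import Data.Integer.Properties
  using (*-cancelˡ-≡; *-identityʳ; +-injective; *-zeroˡ; +-identityˡ; pos-*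
        ; ∣i*j∣≡∣i∣*∣j∣; +∣i∣≡i⊎+∣i∣≡-i)
open import Data.Integer.DivMod using (a≡a%ℕn+[a/ℕn]*n; n%ℕd<d)
open import Data.Integer.Tactic.RingSolver using (solve-∀)
open import Data.Product using (Σ; _×_; _,_; proj₁; proj₂)
open import Data.Sum using (_⊎_; inj₁; inj₂)
open import Data.Empty using (⊥-elim)
open import Function.Bundles using (_⇔_; mk⇔)
open import Relation.Binary.PropositionalEquality

infix 5 _+_i
infixl 6 _⊕_
infixl 7 _·_ _⋆_

record ℤ[i] : Set where
  constructor _+_i
  field
    re im : ℤ

open ℤ[i]

_⊕_ : ℤ[i] → ℤ[i] → ℤ[i]
(a + b i) ⊕ (c + d i) = (a + c) + (b + d) i

_·_ : ℤ[i] → ℤ[i] → ℤ[i]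
(a + b i) · (c + d i) = (a * c - b * d) + (a * d + b * c) i

_⋆_ : ℤ → ℤ[i] → ℤ[i]
k ⋆ (a + b i) = (k * a) + (k * b) i

conj : ℤ[i] → ℤ[i]
conj (a + b i) = a + (- b) i

N : ℤ[i] → ℤ
N (a + b i) = a * a + b * b

-- solve-∀ does not unfold _·_, N, conj or form, so identities about them go through helpers
-- stated on the components.
·-identityˡ : ∀ α → (1ℤ + 0ℤ i) · α ≡ α
·-identityˡ (a + b i) = cong₂ _+_i (re-eq a) (im-eq a b)
  where
  re-eq : ∀ a → 1ℤ * a - 0ℤ * 1ℤ ≡ a
  re-eq = solve-∀
  im-eq : ∀ a b → 1ℤ * b + 0ℤ * a ≡ b
  im-eq = solve-∀

N-· : ∀ α β → N (α · β) ≡ N α * N β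
N-· (a + b i) (c + d i) = brahmagupta a b c d
  where
  brahmagupta : ∀ a b c d →
    (a * c - b * d) * (a * c - b * d) + (a * d + b * c) * (a * d + b * c) ≡
    (a * a + b * b) * (c * c + d * d)
  brahmagupta = solve-∀

N-⋆ : ∀ k α → N (k ⋆ α) ≡ k * (k * N α)
N-⋆ k (a + b i) = identity k a b
  where
  identity : ∀ k a b → k * a * (k * a) + k * b * (k * b) ≡ k * (k * (a * a + b * b))
  identity = solve-∀

N-conj : ∀ α → N (conj α) ≡ N α
N-conj (a + b i) = identity a b
  where
  identity : ∀ a b → a * a + (- b) * (- b) ≡ a * a + b * b
  identity = solve-∀

⋆-cancel : ∀ k .{{_ : ℤ.NonZero k}} {α β} → k ⋆ α ≡ k ⋆ β → α ≡ β
⋆-cancel k eq = cong₂ _+_i (*-cancelˡ-≡ k _ _ (cong re eq)) (*-cancelˡ-≡ k _ _ (cong im eq))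

⋆-·-assoc : ∀ k α β → (k ⋆ α) · β ≡ k ⋆ (α · β)
⋆-·-assoc k (a + b i) (c + d i) = cong₂ _+_i (re-eq k a b c d) (im-eq k a b c d)
  where
  re-eq : ∀ k a b c d → k * a * c - k * b * d ≡ k * (a * c - b * d)
  re-eq = solve-∀
  im-eq : ∀ k a b c d → k * a * d + k * b * c ≡ k * (a * d + b * c)
  im-eq = solve-∀

·-⊕-⋆-conj : ∀ α β q → β · (α ⊕ q ⋆ conj β) ≡ α · β ⊕ (q * N β + 0ℤ i)
·-⊕-⋆-conj (a + b i) (c + d i) q = cong₂ _+_i (re-eq a b c d q) (im-eq a b c d q)
  where
  re-eq : ∀ a b c d q → c * (a + q * c) - d * (b + q * - d) ≡ a * c - b * d + q * (c * c + d * d)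
  re-eq = solve-∀
  im-eq : ∀ a b c d q → c * (b + q * - d) + d * (a + q * c) ≡ a * d + b * c + 0ℤ
  im-eq = solve-∀

·-conj-·-square : ∀ α β → (β · conj α) · (α · α) ≡ N α ⋆ (α · β)
·-conj-·-square (a + b i) (c + d i) = cong₂ _+_i (re-eq a b c d) (im-eq a b c d)
  where
  re-eq : ∀ a b c d →
    (c * a - d * - b) * (a * a - b * b) - (c * - b + d * a) * (a * b + b * a) ≡
    (a * a + b * b) * (a * c - b * d)
  re-eq = solve-∀
  im-eq : ∀ a b c d →
    (c * a - d * - b) * (a * b + b * a) + (c * - b + d * a) * (a * a - b * b) ≡
    (a * a + b * b) * (a * d + b * c)
  im-eq = solve-∀

x*x≡+∣x∣*+∣x∣ : ∀ x → x * x ≡ + ∣ x ∣ * + ∣ x ∣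
x*x≡+∣x∣*+∣x∣ (+ n)    = refl
x*x≡+∣x∣*+∣x∣ -[1+ n ] = refl

x*x+1≢0 : ∀ x → x * x + 1ℤ ≢ 0ℤ
x*x+1≢0 x eq = ℕ.m+1+n≢0 (∣ x ∣ ℕ.* ∣ x ∣) (+-injective (trans (sym x*x+1≡) eq))
  where
  x*x+1≡ : x * x + 1ℤ ≡ + (∣ x ∣ ℕ.* ∣ x ∣ ℕ.+ 1)
  x*x+1≡ = cong (_+ 1ℤ) (trans (x*x≡+∣x∣*+∣x∣ x) (sym (pos-* ∣ x ∣ ∣ x ∣)))

x*x+1≡n*k⇒NonZero : ∀ {n} x k → x * x + 1ℤ ≡ + n * k → NonZero n
x*x+1≡n*k⇒NonZero {zero}  x k eq = ⊥-elim (x*x+1≢0 x (trans eq (*-zeroˡ k)))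
x*x+1≡n*k⇒NonZero {suc n} x k eq = _

x*x+1≡n*k-mod : ∀ r q n k → (r + q * n) * (r + q * n) + 1ℤ ≡ n * k →
            r * r + 1ℤ ≡ n * (k - + 2 * r * q - q * q * n)
x*x+1≡n*k-mod r q n k eq = begin
  r * r + 1ℤ                                                   ≡⟨ expand r q n ⟩
  (r + q * n) * (r + q * n) + 1ℤ - n * (+ 2 * r * q + q * q * n) ≡⟨ cong (_- n * (+ 2 * r * q + q * q * n)) eq ⟩
  n * k - n * (+ 2 * r * q + q * q * n)                          ≡⟨ factor n k r q ⟩
  n * (k - + 2 * r * q - q * q * n)                              ∎
  where
  open ≡-Reasoning
  expand : ∀ r q n → r * r + 1ℤ ≡ (r + q * n) * (r + q * n) + 1ℤ - n * (+ 2 * r * q + q * q * n)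
  expand = solve-∀
  factor : ∀ n k r q → n * k - n * (+ 2 * r * q + q * q * n) ≡ n * (k - + 2 * r * q - q * q * n)
  factor = solve-∀

m*m+1≡n*k⇒k<n : ∀ {m n k} → m ℕ.< suc (suc n) → m ℕ.* m ℕ.+ 1 ≡ suc (suc n) ℕ.* k → k ℕ.< suc (suc n)
m*m+1≡n*k⇒k<n {m} {n} {k} m<n+2 eq = ℕ.*-cancelˡ-< (suc (suc n)) k (suc (suc n)) (begin-strict
  suc (suc n) ℕ.* k                     ≡⟨ sym eq ⟩
  m ℕ.* m ℕ.+ 1                         ≤⟨ ℕ.+-monoˡ-≤ 1 (ℕ.*-mono-≤ m≤n+1 m≤n+1) ⟩
  suc n ℕ.* suc n ℕ.+ 1                 <⟨ ℕ.m<m+n _ ℕ.z<s ⟩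
  suc n ℕ.* suc n ℕ.+ 1 ℕ.+ (2 ℕ.+ 2 ℕ.* n) ≡⟨ expand n ⟩
  suc (suc n) ℕ.* suc (suc n)           ∎)
  where
  open ℕ.≤-Reasoning
  m≤n+1 : m ℕ.≤ suc n
  m≤n+1 = ℕ.s≤s⁻¹ m<n+2
  expand : ∀ n → suc n ℕ.* suc n ℕ.+ 1 ℕ.+ (2 ℕ.+ 2 ℕ.* n) ≡ suc (suc n) ℕ.* suc (suc n)
  expand = ℕ-solve-∀

+r*+r+1≡+[r*r+1] : ∀ r → + r * + r + 1ℤ ≡ + (r ℕ.* r ℕ.+ 1)
+r*+r+1≡+[r*r+1] r = cong (_+ 1ℤ) (sym (pos-* r r))

NormFactor : ℕ → ℤ → Set
NormFactor n x = Σ ℤ[i] λ α → Σ ℤ[i] λ β → N α ≡ + n × α · β ≡ x + 1ℤ i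

cofactor-norm : ∀ {n k x} α β → x * x + 1ℤ ≡ + n * k → N α ≡ + n → α · β ≡ x + 1ℤ i → N β ≡ k
cofactor-norm {n} {k} {x} α β eq Nα≡n αβ≡x+i = *-cancelˡ-≡ (+ n) (N β) k (begin
  + n * N β  ≡⟨ cong (_* N β) (sym Nα≡n) ⟩
  N α * N β  ≡⟨ sym (N-· α β) ⟩
  N (α · β)  ≡⟨ cong N αβ≡x+i ⟩
  x * x + 1ℤ ≡⟨ eq ⟩
  + n * k    ∎)
  where
  open ≡-Reasoning
  instance
    n≢0 : NonZero n
    n≢0 = x*x+1≡n*k⇒NonZero x k eq

normFactor-lift : ∀ {n k r} q → + r * + r + 1ℤ ≡ + k * + n →
                  NormFactor k (+ r) → NormFactor n (+ r + q * + n)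
normFactor-lift {n} {k} {r} q eq (α , β , Nα≡k , αβ≡r+i) = β , α ⊕ q ⋆ conj β , Nβ≡n , (begin
  β · (α ⊕ q ⋆ conj β)     ≡⟨ ·-⊕-⋆-conj α β q ⟩
  α · β ⊕ (q * N β + 0ℤ i) ≡⟨ cong₂ (λ γ m → γ ⊕ (q * m + 0ℤ i)) αβ≡r+i Nβ≡n ⟩
  (+ r + q * + n) + 1ℤ i   ∎)
  where
  open ≡-Reasoning
  Nβ≡n : N β ≡ + n
  Nβ≡n = cofactor-norm α β eq Nα≡k αβ≡r+i

normFactor : ∀ n x k → x * x + 1ℤ ≡ + n * k → NormFactor n x
normFactor = <-rec HasNormFactors descent
  where
  HasNormFactors : ℕ → Set
  HasNormFactors n = ∀ x k → x * x + 1ℤ ≡ + n * k → NormFactor n x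
  descent : ∀ n → (∀ {m} → m ℕ.< n → HasNormFactors m) → HasNormFactors n
  descent zero       _ x k eq = ⊥-elim (x*x+1≢0 x (trans eq (*-zeroˡ k)))
  descent (suc zero) _ x k eq = 1ℤ + 0ℤ i , x + 1ℤ i , refl , ·-identityˡ (x + 1ℤ i)
  descent n@(suc (suc _)) rec x k eq =
    subst (NormFactor n) (sym x≡r+qn) (normFactor-lift q r*r+1≡k′*n (rec k′<n (+ r) (+ n) r*r+1≡k′*n))
    where
    r : ℕ
    r = x %ℕ n
    q : ℤ
    q = x /ℕ n
    x≡r+qn : x ≡ + r + q * + n
    x≡r+qn = a≡a%ℕn+[a/ℕn]*n x n
    k′ : ℤ
    k′ = k - + 2 * + r * q - q * q * + n
    r*r+1≡n*k′ : + r * + r + 1ℤ ≡ + n * k′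
    r*r+1≡n*k′ = x*x+1≡n*k-mod (+ r) q (+ n) k (subst (λ y → y * y + 1ℤ ≡ + n * k) x≡r+qn eq)
    r*r+1≡n*∣k′∣ : r ℕ.* r ℕ.+ 1 ≡ n ℕ.* ∣ k′ ∣
    r*r+1≡n*∣k′∣ =
      trans (cong ∣_∣ (trans (sym (+r*+r+1≡+[r*r+1] r)) r*r+1≡n*k′)) (∣i*j∣≡∣i∣*∣j∣ (+ n) k′)
    r*r+1≡k′*n : + r * + r + 1ℤ ≡ + ∣ k′ ∣ * + n
    r*r+1≡k′*n = trans (+r*+r+1≡+[r*r+1] r)
      (trans (cong +_ (trans r*r+1≡n*∣k′∣ (ℕ.*-comm n ∣ k′ ∣))) (pos-* ∣ k′ ∣ n))
    k′<n : ∣ k′ ∣ ℕ.< n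
    k′<n = m*m+1≡n*k⇒k<n (n%ℕd<d x n) r*r+1≡n*∣k′∣

-- −x inverts x modulo Y.
x*x+1≡Y*c⇒Y*t≡d*x⇒Y∣d : ∀ {Y x c d t} → x * x + 1ℤ ≡ Y * c → Y * t ≡ d * x →
                         Y * (d * c - x * t) ≡ d
x*x+1≡Y*c⇒Y*t≡d*x⇒Y∣d {Y} {x} {c} {d} {t} eq Y*t≡d*x = begin
  Y * (d * c - x * t)            ≡⟨ expand Y d c x t ⟩
  d * (Y * c) - x * (Y * t)      ≡⟨ cong₂ (λ m n → d * m - x * n) (sym eq) Y*t≡d*x ⟩
  d * (x * x + 1ℤ) - x * (d * x) ≡⟨ cancel d x ⟩
  d                              ∎
  where
  open ≡-Reasoning
  expand : ∀ Y d c x t → Y * (d * c - x * t) ≡ d * (Y * c) - x * (Y * t)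
  expand = solve-∀
  cancel : ∀ d x → d * (x * x + 1ℤ) - x * (d * x) ≡ d
  cancel = solve-∀

-- Y divides Re(β ᾱ) because Im(α β) = 1, and Y divides x Im(β ᾱ) because Re(α β) = x.
conj-quotient : ∀ {A Y x} α β → x * x + 1ℤ ≡ Y * (A * Y) →
                N α ≡ Y → N β ≡ A * Y → α · β ≡ x + 1ℤ i →
                Σ ℤ[i] λ γ → Y ⋆ γ ≡ β · conj α
conj-quotient {A} {Y} {x} (a + b i) (u + v i) eq Nα≡Y Nβ≡AY αβ≡x+i =
  (u * v + a * b * A) + (d * (A * Y) - x * (u * v - a * b * A)) i ,
  cong₂ _+_i Y∣re (x*x+1≡Y*c⇒Y*t≡d*x⇒Y∣d {Y} {x} {A * Y} {d} eq Y*t≡d*x)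
  where
  open ≡-Reasoning
  expand-re : ∀ Y u v a b A → Y * (u * v + a * b * A) ≡ u * v * Y + a * b * (A * Y)
  expand-re = solve-∀
  expand-im : ∀ Y u v a b A → Y * (u * v - a * b * A) ≡ u * v * Y - a * b * (A * Y)
  expand-im = solve-∀
  factor-re : ∀ u v a b →
    u * v * (a * a + b * b) + a * b * (u * u + v * v) ≡ (u * a - v * - b) * (a * v + b * u)
  factor-re = solve-∀
  factor-im : ∀ u v a b →
    u * v * (a * a + b * b) - a * b * (u * u + v * v) ≡ (u * - b + v * a) * (a * u - b * v)
  factor-im = solve-∀
  d : ℤ
  d = u * - b + v * a
  Y∣re : Y * (u * v + a * b * A) ≡ u * a - v * - b
  Y∣re = begin
    Y * (u * v + a * b * A)                           ≡⟨ expand-re Y u v a b A ⟩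
    u * v * Y + a * b * (A * Y)                       ≡⟨ cong₂ (λ m n → u * v * m + a * b * n) (sym Nα≡Y) (sym Nβ≡AY) ⟩
    u * v * (a * a + b * b) + a * b * (u * u + v * v) ≡⟨ factor-re u v a b ⟩
    (u * a - v * - b) * (a * v + b * u)               ≡⟨ cong ((u * a - v * - b) *_) (cong im αβ≡x+i) ⟩
    (u * a - v * - b) * 1ℤ                            ≡⟨ *-identityʳ _ ⟩
    u * a - v * - b                                   ∎
  Y*t≡d*x : Y * (u * v - a * b * A) ≡ d * x
  Y*t≡d*x = begin
    Y * (u * v - a * b * A)                           ≡⟨ expand-im Y u v a b A ⟩
    u * v * Y - a * b * (A * Y)                       ≡⟨ cong₂ (λ m n → u * v * m - a * b * n) (sym Nα≡Y) (sym Nβ≡AY) ⟩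
    u * v * (a * a + b * b) - a * b * (u * u + v * v) ≡⟨ factor-im u v a b ⟩
    d * (a * u - b * v)                               ≡⟨ cong (d *_) (cong re αβ≡x+i) ⟩
    d * x                                             ∎

SquareFactor : ℕ → ℤ → Set
SquareFactor A x = Σ ℤ[i] λ γ → Σ ℤ[i] λ α → N γ ≡ + A × γ · (α · α) ≡ x + 1ℤ i

normFactor⇒squareFactor : ∀ {A Y} x → x * x + 1ℤ ≡ + Y * (+ A * + Y) → NormFactor Y x → SquareFactor A x
normFactor⇒squareFactor {A} {Y} x eq (α , β , Nα≡Y , αβ≡x+i) = γ , α , Nγ≡A , γα²≡x+i
  where
  open ≡-Reasoning
  instance
    Y≢0 : NonZero Y
    Y≢0 = x*x+1≡n*k⇒NonZero x (+ A * + Y) eq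
  Nβ≡AY : N β ≡ + A * + Y
  Nβ≡AY = cofactor-norm α β eq Nα≡Y αβ≡x+i
  quotient : Σ ℤ[i] λ γ → + Y ⋆ γ ≡ β · conj α
  quotient = conj-quotient {+ A} α β eq Nα≡Y Nβ≡AY αβ≡x+i
  γ : ℤ[i]
  γ = proj₁ quotient
  Yγ≡βᾱ : + Y ⋆ γ ≡ β · conj α
  Yγ≡βᾱ = proj₂ quotient
  Nγ≡A : N γ ≡ + A
  Nγ≡A = *-cancelˡ-≡ (+ Y) _ _ (*-cancelˡ-≡ (+ Y) _ _ (begin
    + Y * (+ Y * N γ)     ≡⟨ sym (N-⋆ (+ Y) γ) ⟩
    N (+ Y ⋆ γ)           ≡⟨ cong N Yγ≡βᾱ ⟩
    N (β · conj α)        ≡⟨ N-· β (conj α) ⟩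
    N β * N (conj α)      ≡⟨ cong₂ _*_ Nβ≡AY (trans (N-conj α) Nα≡Y) ⟩
    + A * + Y * + Y       ≡⟨ rearrange (+ A) (+ Y) ⟩
    + Y * (+ Y * + A)     ∎))
    where
    rearrange : ∀ A Y → A * Y * Y ≡ Y * (Y * A)
    rearrange = solve-∀
  γα²≡x+i : γ · (α · α) ≡ x + 1ℤ i
  γα²≡x+i = ⋆-cancel (+ Y) (begin
    + Y ⋆ (γ · (α · α))      ≡⟨ sym (⋆-·-assoc (+ Y) γ (α · α)) ⟩
    (+ Y ⋆ γ) · (α · α)      ≡⟨ cong (_· (α · α)) Yγ≡βᾱ ⟩
    (β · conj α) · (α · α)   ≡⟨ ·-conj-·-square α β ⟩
    N α ⋆ (α · β)            ≡⟨ cong₂ _⋆_ Nα≡Y αβ≡x+i ⟩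
    + Y ⋆ (x + 1ℤ i)         ∎)

form : ℤ → ℤ → ℤ → ℤ → ℤ
form r s m n = s * (m * m) - + 2 * r * m * n - s * (n * n)

Is±1 : ℤ → Set
Is±1 z = z ≡ 1ℤ ⊎ z ≡ - 1ℤ

Is±1-neg : ∀ {z} → Is±1 z → Is±1 (- z)
Is±1-neg (inj₁ refl) = inj₂ refl
Is±1-neg (inj₂ refl) = inj₁ refl

Is±1⇒z*z≡1 : ∀ {z} → Is±1 z → z * z ≡ 1ℤ
Is±1⇒z*z≡1 (inj₁ refl) = refl
Is±1⇒z*z≡1 (inj₂ refl) = refl

FormRepresents±1 : ℤ → ℤ → Set
FormRepresents±1 r s = Σ ℤ λ m → Σ ℤ λ n → Is±1 (form r s m n)

form-neg-r : ∀ r s m n → form (- r) s m (- n) ≡ form r s m n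
form-neg-r = identity
  where
  identity : ∀ r s m n →
    s * (m * m) - + 2 * (- r) * m * (- n) - s * ((- n) * (- n)) ≡ s * (m * m) - + 2 * r * m * n - s * (n * n)
  identity = solve-∀

form-neg-s : ∀ r s m n → form r (- s) m (- n) ≡ - form r s m n
form-neg-s = identity
  where
  identity : ∀ r s m n →
    (- s) * (m * m) - + 2 * r * m * (- n) - (- s) * ((- n) * (- n)) ≡ - (s * (m * m) - + 2 * r * m * n - s * (n * n))
  identity = solve-∀

represents-neg-r : ∀ r s → FormRepresents±1 r s → FormRepresents±1 (- r) s
represents-neg-r r s (m , n , unit) = m , - n , subst Is±1 (sym (form-neg-r r s m n)) unit

represents-neg-s : ∀ r s → FormRepresents±1 r s → FormRepresents±1 r (- s)
represents-neg-s r s (m , n , unit) = m , - n , subst Is±1 (sym (form-neg-s r s m n)) (Is±1-neg unit)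

represents-∣r∣ : ∀ r s → FormRepresents±1 r s → FormRepresents±1 (+ ∣ r ∣) s
represents-∣r∣ r s rep with +∣i∣≡i⊎+∣i∣≡-i r
... | inj₁ ∣r∣≡r  = subst (λ t → FormRepresents±1 t s) (sym ∣r∣≡r) rep
... | inj₂ ∣r∣≡-r = subst (λ t → FormRepresents±1 t s) (sym ∣r∣≡-r) (represents-neg-r r s rep)

represents-∣s∣ : ∀ r s → FormRepresents±1 r s → FormRepresents±1 r (+ ∣ s ∣)
represents-∣s∣ r s rep with +∣i∣≡i⊎+∣i∣≡-i s
... | inj₁ ∣s∣≡s  = subst (FormRepresents±1 r) (sym ∣s∣≡s) rep
... | inj₂ ∣s∣≡-s = subst (FormRepresents±1 r) (sym ∣s∣≡-s) (represents-neg-s r s rep)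

im-·-square : ∀ r s a b → im ((r + s i) · ((a + b i) · (a + b i))) ≡ form r s a (- b)
im-·-square = identity
  where
  identity : ∀ r s a b →
    r * (a * b + b * a) + s * (a * a - b * b) ≡ s * (a * a) - + 2 * r * a * (- b) - s * ((- b) * (- b))
  identity = solve-∀

NegativePell : ℕ → Set
NegativePell A = Σ ℤ λ x → Σ ℤ λ y → x * x - + A * (y * y) ≡ - 1ℤ

UnitFormDecomposition : ℕ → Set
UnitFormDecomposition A = Σ ℕ λ r → Σ ℕ λ s → (+ A ≡ + r * + r + + s * + s) × FormRepresents±1 (+ r) (+ s)

squareFactor⇒decomposition : ∀ {A x} → SquareFactor A x → UnitFormDecomposition A
squareFactor⇒decomposition {A} (r + s i , a + b i , Nγ≡A , γα²≡x+i) =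
  ∣ r ∣ , ∣ s ∣ , A≡r²+s² ,
  represents-∣s∣ (+ ∣ r ∣) s (represents-∣r∣ r s (a , - b , inj₁ form≡1))
  where
  A≡r²+s² : + A ≡ + ∣ r ∣ * + ∣ r ∣ + + ∣ s ∣ * + ∣ s ∣
  A≡r²+s² = trans (sym Nγ≡A) (cong₂ _+_ (x*x≡+∣x∣*+∣x∣ r) (x*x≡+∣x∣*+∣x∣ s))
  form≡1 : form r s a (- b) ≡ 1ℤ
  form≡1 = trans (sym (im-·-square r s a b)) (cong im γα²≡x+i)

negativePell⇒decomposition : ∀ A → NegativePell A → UnitFormDecomposition A
negativePell⇒decomposition A (x , y , eq) =
  squareFactor⇒decomposition (normFactor⇒squareFactor x x*x+1≡Y*AY (normFactor Y x (+ A * + Y) x*x+1≡Y*AY))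
  where
  open ≡-Reasoning
  Y : ℕ
  Y = ∣ y ∣
  x*x+1≡Y*AY : x * x + 1ℤ ≡ + Y * (+ A * + Y)
  x*x+1≡Y*AY = begin
    x * x + 1ℤ                                ≡⟨ insert x (+ A) (y * y) ⟩
    x * x - + A * (y * y) + 1ℤ + + A * (y * y) ≡⟨ cong (λ t → t + 1ℤ + + A * (y * y)) eq ⟩
    0ℤ + + A * (y * y)                        ≡⟨ +-identityˡ _ ⟩
    + A * (y * y)                             ≡⟨ cong (+ A *_) (x*x≡+∣x∣*+∣x∣ y) ⟩
    + A * (+ Y * + Y)                         ≡⟨ rearrange (+ A) (+ Y) ⟩
    + Y * (+ A * + Y)                         ∎
    where
    insert : ∀ x a w → x * x + 1ℤ ≡ x * x - a * w + 1ℤ + a * w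
    insert = solve-∀
    rearrange : ∀ a y → a * (y * y) ≡ y * (a * y)
    rearrange = solve-∀

decomposition⇒negativePell : ∀ A → UnitFormDecomposition A → NegativePell A
decomposition⇒negativePell A (r , s , A≡r²+s² , m , n , unit) = x , y , (begin
  x * x - + A * (y * y)                       ≡⟨ cong (λ a → x * x - a * (y * y)) A≡r²+s² ⟩
  x * x - (+ r * + r + + s * + s) * (y * y)   ≡⟨ identity (+ r) (+ s) m n ⟩
  - (form (+ r) (+ s) m n * form (+ r) (+ s) m n) ≡⟨ cong -_ (Is±1⇒z*z≡1 unit) ⟩
  - 1ℤ                                        ∎)
  where
  open ≡-Reasoning
  -- x + G i = (r + s i)(m − n i)² with G = form (+ r) (+ s) m n
  x y : ℤ
  x = + r * (m * m - n * n) + + s * (+ 2 * m * n)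
  y = m * m + n * n
  identity : ∀ r s m n →
    (r * (m * m - n * n) + s * (+ 2 * m * n)) * (r * (m * m - n * n) + s * (+ 2 * m * n))
      - (r * r + s * s) * ((m * m + n * n) * (m * m + n * n))
    ≡ - ((s * (m * m) - + 2 * r * m * n - s * (n * n)) * (s * (m * m) - + 2 * r * m * n - s * (n * n)))
  identity = solve-∀

mainTheorem1 : (A : ℕ) → .{{_ : NonZero A}} →
    (Σ ℤ λ x → Σ ℤ λ y → x * x - (+ A) * (y * y) ≡ - 1ℤ)
    ⇔
    (Σ ℕ λ r → Σ ℕ λ s → (+ A ≡ (+ r) * (+ r) + (+ s) * (+ s)) ×
      (Σ ℤ λ m → Σ ℤ λ n →
        ((+ s) * (m * m) - (+ 2) * (+ r) * m * n - (+ s) * (n * n) ≡ 1ℤ)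
        ⊎ ((+ s) * (m * m) - (+ 2) * (+ r) * m * n - (+ s) * (n * n) ≡ - 1ℤ)))
mainTheorem1 A = mk⇔ (negativePell⇒decomposition A) (decomposition⇒negativePell A)
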